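{- For every positive integer $m$, $d(m,m^2+m)\le 17$.
   Context: An integral point set in the $m$-dimensional Euclidean space $\mathbb{E}^m$ is a set of $n$ points in $\mathbb{E}^m$ whose pairwise Euclidean distances are all integers and which are not all contained in a common affine hyperplane of $\mathbb{E}^m$. Its diameter is the largest distance between two of its points. For integers $n\ge m+1$, $d(m,n)$ denotes the minimum possible diameter of an integral point set in $\mathbb{E}^m$ consisting of $n$ points. -}

module Defs where

open import Level using (Level; _⊔_)
open import Data.Nat as ℕ using (ℕ; zero; suc)
open import Data.Fin as Fin using (Fin)
open import Data.Product using (∃; Σ; _×_; _,_)
open import Relation.Nullary using (¬_)
open import Relation.Binary.Core using (Rel)
open import Relation.Binary.Structures using (IsTotalOrder)
open import Relation.Binary.PropositionalEquality using (_≡_)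
open import Algebra.Bundles using (CommutativeRing)

-- An ordered field in which every non-negative element has a square root
-- (a "Euclidean ordered field"; ℝ is the intended instance).
record OrderedEuclideanField (c ℓ₁ ℓ₂ : Level) : Set (Level.suc (c ⊔ ℓ₁ ⊔ ℓ₂)) where
  field
    commutativeRing : CommutativeRing c ℓ₁
  open CommutativeRing commutativeRing public
  field
    _≤_          : Rel Carrier ℓ₂
    isTotalOrder : IsTotalOrder _≈_ _≤_
    +-mono-≤     : ∀ {a b} z → a ≤ b → (a + z) ≤ (b + z)
    *-nonneg     : ∀ {a b} → 0# ≤ a → 0# ≤ b → 0# ≤ (a * b)
    0≉1          : ¬ (0# ≈ 1#)
    inverse      : ∀ x → ¬ (x ≈ 0#) → Σ Carrier (λ y → (x * y) ≈ 1#)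
    sqrt         : ∀ x → 0# ≤ x → Σ Carrier (λ y → (y * y) ≈ x)

module Euclidean {c ℓ₁ ℓ₂} (F : OrderedEuclideanField c ℓ₁ ℓ₂) where
  open OrderedEuclideanField F using (Carrier; _≈_; _+_; _*_; _-_; 0#; 1#)

  Σᶠ : ∀ {m} → (Fin m → Carrier) → Carrier
  Σᶠ {zero}  f = 0#
  Σᶠ {suc m} f = f Fin.zero + Σᶠ (λ k → f (Fin.suc k))

  fromℕ : ℕ → Carrier
  fromℕ zero    = 0#
  fromℕ (suc n) = 1# + fromℕ n

  Point : ℕ → Set c
  Point m = Fin m → Carrier

  dist² : ∀ {m} → Point m → Point m → Carrier
  dist² p q = Σᶠ (λ k → (p k - q k) * (p k - q k))

  DistIs : ∀ {m} → Point m → Point m → ℕ → Set ℓ₁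
  DistIs p q d = dist² p q ≈ (fromℕ d * fromℕ d)

  Distinct : ∀ {m n} → (Fin n → Point m) → Set ℓ₁
  Distinct P = ∀ i j → ¬ (i ≡ j) → ¬ (∀ k → P i k ≈ P j k)

  InHyperplane : ∀ {m n} → (Fin n → Point m) → Set (c ⊔ ℓ₁)
  InHyperplane {m} P =
    Σ (Point m) λ a → Σ Carrier λ b →
      (Σ (Fin m) λ k → ¬ (a k ≈ 0#)) × (∀ i → Σᶠ (λ k → a k * P i k) ≈ b)

  IsIntegralPointSet : ∀ {m n} → (Fin n → Point m) → Set (c ⊔ ℓ₁)
  IsIntegralPointSet P =
    Distinct P × (∀ i j → ∃ λ d → DistIs (P i) (P j) d) × ¬ InHyperplane P

  DiameterAtMost : ∀ {m n} → (Fin n → Point m) → ℕ → Set ℓ₁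
  DiameterAtMost P D = ∀ i j → ∃ λ d → (d ℕ.≤ D) × DistIs (P i) (P j) d

  -- d(m,n) ≤ D : some integral point set in E^m with n points has diameter ≤ D
  d≤ : ℕ → ℕ → ℕ → Set (c ⊔ ℓ₁)
  d≤ m n D = Σ (Fin n → Point m) λ P → IsIntegralPointSet P × DiameterAtMost P D

-- Let s₀, …, sₘ be the vertices of a regular simplex of edge length 1 in Eᵐ and take the m(m+1)
-- points 8sᵢ + 15sⱼ with i ≠ j.  By polarisation the squared distance between 8sᵢ + 15sⱼ and
-- 8sₖ + 15sₗ is 64[i≠k] + 225[j≠l] + 120([i≠l] + [k≠j] − 2), which is one of 0, 8², 15², 7², 13², 17².
-- If all the points lay on a hyperplane a·x = b, comparing 8sᵢ + 15sⱼ with 8sⱼ + 15sᵢ would give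
-- 7 a·(sᵢ − sⱼ) = 0, so a·x would be constant on the vertices; as these affinely span Eᵐ, a = 0.

module Submission where

open import Defs
open import Level using (_⊔_)
open import Data.Nat as ℕ using (ℕ; zero; suc)
import Data.Nat.Properties as ℕP
open import Data.Integer as ℤ using (ℤ; +_; -[1+_])
import Data.Integer.Properties as ℤP
open import Data.Sign as Sign using (Sign)
open import Data.Fin as Fin using (Fin; punchIn; punchOut; remQuot; combine)
import Data.Fin.Properties as FinP
open import Data.Product using (∃; _,_; proj₁; proj₂; _×_; uncurry)
open import Data.Product.Properties using (,-injectiveˡ; ,-injectiveʳ)
open import Data.Maybe using (Maybe; just; nothing)
open import Data.Sum using (inj₁; inj₂)
open import Data.Empty using (⊥-elim)
open import Function using (_∘_)
open import Relation.Nullary using (¬_; yes; no; contradiction)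
open import Relation.Binary.PropositionalEquality as ≡ using (_≡_; _≢_; module ≡-Reasoning)
open import Relation.Binary.Structures using (IsTotalOrder)
open import Algebra.Solver.Ring.AlmostCommutativeRing using (fromCommutativeRing; _-Raw-AlmostCommutative⟶_)
import Algebra.Solver.Ring
import Algebra.Solver.Ring.NaturalCoefficients.Default as ℕ-Solver
import Algebra.Properties.Ring as RingProperties

punchPair : ∀ {m} → Fin (suc m) × Fin m → Fin (suc m) × Fin (suc m)
punchPair (i , r) = i , punchIn i r

punchPair-≢ : ∀ {m} (p : Fin (suc m) × Fin m) → proj₁ (punchPair p) ≢ proj₂ (punchPair p)
punchPair-≢ (i , r) = FinP.punchInᵢ≢i i r ∘ ≡.sym

punchPair-injective : ∀ {m} {p q : Fin (suc m) × Fin m} → punchPair p ≡ punchPair q → p ≡ q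
punchPair-injective {p = i , r} {q = j , s} eq with ,-injectiveˡ eq
... | ≡.refl = ≡.cong (i ,_) (FinP.punchIn-injective i r s (,-injectiveʳ eq))

offDiagonal : ∀ m → Fin (suc m ℕ.* m) → Fin (suc m) × Fin (suc m)
offDiagonal m = punchPair ∘ remQuot m

offDiagonal-≢ : ∀ m (x : Fin (suc m ℕ.* m)) → proj₁ (offDiagonal m x) ≢ proj₂ (offDiagonal m x)
offDiagonal-≢ m x = punchPair-≢ (remQuot m x)

offDiagonal-injective : ∀ m {x y : Fin (suc m ℕ.* m)} → offDiagonal m x ≡ offDiagonal m y → x ≡ y
offDiagonal-injective m {x} {y} eq = begin
  x                             ≡⟨ FinP.combine-remQuot {suc m} m x ⟨
  uncurry combine (remQuot m x) ≡⟨ ≡.cong (uncurry combine) (punchPair-injective {p = remQuot m x} {q = remQuot m y} eq) ⟩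
  uncurry combine (remQuot m y) ≡⟨ FinP.combine-remQuot {suc m} m y ⟩
  y                             ∎
  where open ≡-Reasoning

offDiagonal-surjective : ∀ m {i j : Fin (suc m)} → i ≢ j → ∃ λ x → offDiagonal m x ≡ (i , j)
offDiagonal-surjective m {i} {j} i≢j = combine i (punchOut i≢j) , (begin
  punchPair (remQuot m (combine i (punchOut i≢j))) ≡⟨ ≡.cong punchPair (FinP.remQuot-combine i (punchOut i≢j)) ⟩
  i , punchIn i (punchOut i≢j)                     ≡⟨ ≡.cong (i ,_) (FinP.punchIn-punchOut i≢j) ⟩
  i , j                                            ∎)
  where open ≡-Reasoning

apart : ∀ {n} → Fin n → Fin n → ℕ
apart i j with i Fin.≟ j
... | yes _ = 0
... | no _  = 1

pairDistance : ∀ {n} → Fin n × Fin n → Fin n × Fin n → ℕ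
pairDistance (i , j) (k , l) with i Fin.≟ k | j Fin.≟ l | i Fin.≟ l | k Fin.≟ j
... | yes _ | yes _ | _     | _     = 0
... | yes _ | no _  | _     | _     = 15
... | no _  | yes _ | _     | _     = 8
... | no _  | no _  | yes _ | yes _ = 7
... | no _  | no _  | yes _ | no _  = 13
... | no _  | no _  | no _  | yes _ = 13
... | no _  | no _  | no _  | no _  = 17

pairDistance≤17 : ∀ {n} (p q : Fin n × Fin n) → pairDistance p q ℕ.≤ 17
pairDistance≤17 (i , j) (k , l) with i Fin.≟ k | j Fin.≟ l | i Fin.≟ l | k Fin.≟ j
... | yes _ | yes _ | _     | _     = ℕ.z≤n
... | yes _ | no _  | _     | _     = ℕP.m≤m+n 15 2
... | no _  | yes _ | _     | _     = ℕP.m≤m+n 8 9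
... | no _  | no _  | yes _ | yes _ = ℕP.m≤m+n 7 10
... | no _  | no _  | yes _ | no _  = ℕP.m≤m+n 13 4
... | no _  | no _  | no _  | yes _ = ℕP.m≤m+n 13 4
... | no _  | no _  | no _  | no _  = ℕP.≤-refl

pairDistance≡0⇒≡ : ∀ {n} (p q : Fin n × Fin n) → pairDistance p q ≡ 0 → p ≡ q
pairDistance≡0⇒≡ (i , j) (k , l) with i Fin.≟ k | j Fin.≟ l | i Fin.≟ l | k Fin.≟ j
... | yes ≡.refl | yes ≡.refl | _     | _     = λ _ → ≡.refl
... | yes _      | no _       | _     | _     = λ ()
... | no _       | yes _      | _     | _     = λ ()
... | no _       | no _       | yes _ | yes _ = λ ()
... | no _       | no _       | yes _ | no _  = λ ()
... | no _       | no _       | no _  | yes _ = λ ()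
... | no _       | no _       | no _  | no _  = λ ()

-- The distance formula with 240 = 120 · 2 moved to the right, so that no truncated subtraction occurs.
pairDistance-square : ∀ {n} {i j k l : Fin n} → i ≢ j → k ≢ l →
  64 ℕ.* apart i k ℕ.+ 225 ℕ.* apart j l ℕ.+ 120 ℕ.* (apart i l ℕ.+ apart k j) ≡
  pairDistance (i , j) (k , l) ℕ.* pairDistance (i , j) (k , l) ℕ.+ 240
pairDistance-square {i = i} {j} {k} {l} i≢j k≢l with i Fin.≟ k | j Fin.≟ l | i Fin.≟ l | k Fin.≟ j
... | yes ≡.refl | yes ≡.refl | yes i≡j | _       = contradiction i≡j i≢j
... | yes ≡.refl | yes ≡.refl | no _    | yes i≡j = contradiction i≡j i≢j
... | yes ≡.refl | yes ≡.refl | no _    | no _    = ≡.refl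
... | yes ≡.refl | no _       | yes i≡l | _       = contradiction i≡l k≢l
... | yes ≡.refl | no _       | no _    | yes i≡j = contradiction i≡j i≢j
... | yes ≡.refl | no _       | no _    | no _    = ≡.refl
... | no _       | yes ≡.refl | yes i≡j | _       = contradiction i≡j i≢j
... | no _       | yes ≡.refl | no _    | yes k≡j = contradiction k≡j k≢l
... | no _       | yes ≡.refl | no _    | no _    = ≡.refl
... | no _       | no _       | yes _   | yes _   = ≡.refl
... | no _       | no _       | yes _   | no _    = ≡.refl
... | no _       | no _       | no _    | yes _   = ≡.refl
... | no _       | no _       | no _    | no _    = ≡.refl

module _ {r ℓ₁ ℓ₂} (F : OrderedEuclideanField r ℓ₁ ℓ₂) where
  open OrderedEuclideanField F
  open Euclidean F
  open RingProperties ring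
    using (-‿involutive; -0#≈0#; -‿+-comm; -1*x≈-x; x∙y⁻¹≈ε⇒x≈y; x≈y⇒x∙y⁻¹≈ε)
  open import Algebra.Properties.Semiring.Mult.TCOptimised semiring using (1+×; ×-homo-+; ×1-homo-*)
    renaming (_×_ to _×′_)
  open import Relation.Binary.Reasoning.Setoid setoid

  -- Coefficients for the ring solver.  Sending + n to n ×′ 1# rather than to fromℕ n makes the
  -- solver constant con (+ 1) denote 1# itself.
  fromℤ : ℤ → Carrier
  fromℤ (+ n)    = n ×′ 1#
  fromℤ -[1+ n ] = - (suc n ×′ 1#)

  fromℤ-neg : ∀ z → fromℤ (ℤ.- z) ≈ - fromℤ z
  fromℤ-neg -[1+ n ]    = sym (-‿involutive _)
  fromℤ-neg (+ zero)    = sym -0#≈0#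
  fromℤ-neg (+ (suc n)) = refl

  fromℤ-⊖ : ∀ a b → fromℤ (a ℤ.⊖ b) ≈ a ×′ 1# - b ×′ 1#
  fromℤ-⊖ a       zero    = sym (trans (+-cong refl -0#≈0#) (+-identityʳ _))
  fromℤ-⊖ zero    (suc b) = sym (+-identityˡ _)
  fromℤ-⊖ (suc a) (suc b) = begin
    fromℤ (suc a ℤ.⊖ suc b)           ≡⟨ ≡.cong fromℤ (ℤP.[1+m]⊖[1+n]≡m⊖n a b) ⟩
    fromℤ (a ℤ.⊖ b)                   ≈⟨ fromℤ-⊖ a b ⟩
    a′ - b′                           ≈⟨ +-identityˡ _ ⟨
    0# + (a′ - b′)                    ≈⟨ +-cong (-‿inverseʳ 1#) refl ⟨
    (1# - 1#) + (a′ - b′)             ≈⟨ ℕ-Solver.solve commutativeSemiring 4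
                                           (λ x x' y y' → (x :+ x') :+ (y :+ y') := (x :+ y) :+ (x' :+ y'))
                                           refl 1# (- 1#) a′ (- b′) ⟩
    (1# + a′) + (- 1# - b′)           ≈⟨ +-cong refl (-‿+-comm 1# b′) ⟩
    (1# + a′) - (1# + b′)             ≈⟨ +-cong (1+× a 1#) (-‿cong (1+× b 1#)) ⟨
    suc a ×′ 1# - suc b ×′ 1#         ∎
    where
    open ℕ-Solver commutativeSemiring using (_:+_; _:=_)
    a′ = a ×′ 1#
    b′ = b ×′ 1#

  fromℤ-+ : ∀ x y → fromℤ (x ℤ.+ y) ≈ fromℤ x + fromℤ y
  fromℤ-+ (+ a)    (+ b)    = ×-homo-+ 1# a b
  fromℤ-+ (+ a)    -[1+ b ] = fromℤ-⊖ a (suc b)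
  fromℤ-+ -[1+ a ] (+ b)    = trans (fromℤ-⊖ b (suc a)) (+-comm _ _)
  fromℤ-+ -[1+ a ] -[1+ b ] = begin
    - (suc (suc (a ℕ.+ b)) ×′ 1#)            ≡⟨ ≡.cong (λ k → - (suc k ×′ 1#)) (ℕP.+-suc a b) ⟨
    - ((suc a ℕ.+ suc b) ×′ 1#)              ≈⟨ -‿cong (×-homo-+ 1# (suc a) (suc b)) ⟩
    - (suc a ×′ 1# + suc b ×′ 1#)            ≈⟨ -‿+-comm _ _ ⟨
    - (suc a ×′ 1#) - suc b ×′ 1#            ∎

  fromSign : Sign → Carrier
  fromSign Sign.+ = 1#
  fromSign Sign.- = - 1#

  fromSign-* : ∀ s t → fromSign (s Sign.* t) ≈ fromSign s * fromSign t
  fromSign-* Sign.- Sign.- = sym (trans (-1*x≈-x (- 1#)) (-‿involutive 1#))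
  fromSign-* Sign.- Sign.+ = sym (*-identityʳ _)
  fromSign-* Sign.+ t      = sym (*-identityˡ _)

  fromℤ-◃ : ∀ s n → fromℤ (s ℤ.◃ n) ≈ fromSign s * n ×′ 1#
  fromℤ-◃ s      zero    = sym (zeroʳ _)
  fromℤ-◃ Sign.+ (suc n) = sym (*-identityˡ _)
  fromℤ-◃ Sign.- (suc n) = sym (-1*x≈-x _)

  fromℤ-signAbs : ∀ z → fromℤ z ≈ fromSign (ℤ.sign z) * ℤ.∣ z ∣ ×′ 1#
  fromℤ-signAbs z = begin
    fromℤ z                             ≡⟨ ≡.cong fromℤ (ℤP.◃-inverse z) ⟨
    fromℤ (ℤ.sign z ℤ.◃ ℤ.∣ z ∣)        ≈⟨ fromℤ-◃ (ℤ.sign z) ℤ.∣ z ∣ ⟩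
    fromSign (ℤ.sign z) * ℤ.∣ z ∣ ×′ 1# ∎

  fromℤ-* : ∀ x y → fromℤ (x ℤ.* y) ≈ fromℤ x * fromℤ y
  fromℤ-* x y = begin
    fromℤ ((sx Sign.* sy) ℤ.◃ (∣x∣ ℕ.* ∣y∣))         ≈⟨ fromℤ-◃ (sx Sign.* sy) (∣x∣ ℕ.* ∣y∣) ⟩
    fromSign (sx Sign.* sy) * (∣x∣ ℕ.* ∣y∣) ×′ 1#    ≈⟨ *-cong (fromSign-* sx sy) (×1-homo-* ∣x∣ ∣y∣) ⟩
    (fromSign sx * fromSign sy) * (∣x∣ ×′ 1# * ∣y∣ ×′ 1#)
      ≈⟨ ℕ-Solver.solve commutativeSemiring 4 (λ a b p q → (a :* b) :* (p :* q) := (a :* p) :* (b :* q)) refl _ _ _ _ ⟩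
    (fromSign sx * ∣x∣ ×′ 1#) * (fromSign sy * ∣y∣ ×′ 1#) ≈⟨ *-cong (fromℤ-signAbs x) (fromℤ-signAbs y) ⟨
    fromℤ x * fromℤ y                                 ∎
    where
    open ℕ-Solver commutativeSemiring using (_:*_; _:=_)
    sx = ℤ.sign x
    sy = ℤ.sign y
    ∣x∣ = ℤ.∣ x ∣
    ∣y∣ = ℤ.∣ y ∣

  ℤ-morphism : ℤ.+-*-rawRing -Raw-AlmostCommutative⟶ fromCommutativeRing commutativeRing
  ℤ-morphism = record
    { ⟦_⟧    = fromℤ
    ; +-homo = fromℤ-+
    ; *-homo = fromℤ-*
    ; -‿homo = fromℤ-neg
    ; 0-homo = refl
    ; 1-homo = refl
    }

  fromℤ-≟ : ∀ x y → Maybe (fromℤ x ≈ fromℤ y)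
  fromℤ-≟ x y with x ℤP.≟ y
  ... | yes ≡.refl = just refl
  ... | no _       = nothing

  module ℤ-Solver = Algebra.Solver.Ring ℤ.+-*-rawRing (fromCommutativeRing commutativeRing) ℤ-morphism fromℤ-≟

  open ℤ-Solver using (solve; _:+_; _:-_; _:*_; con; _:=_)
  private module ≤ = IsTotalOrder isTotalOrder

  0≤1 : 0# ≤ 1#
  0≤1 with ≤.total 0# 1#
  ... | inj₁ 0≤1 = 0≤1
  ... | inj₂ 1≤0 = ≤.trans (*-nonneg 0≤-1 0≤-1) (≤.reflexive -1*-1≈1)
    where
    0≤-1 : 0# ≤ (- 1#)
    0≤-1 = ≤.trans (≤.reflexive (sym (-‿inverseʳ 1#)))
             (≤.trans (+-mono-≤ (- 1#) 1≤0) (≤.reflexive (+-identityˡ (- 1#))))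
    -1*-1≈1 : - 1# * - 1# ≈ 1#
    -1*-1≈1 = trans (-1*x≈-x (- 1#)) (-‿involutive 1#)

  0≤×1 : ∀ n → 0# ≤ (n ×′ 1#)
  1≤suc×1 : ∀ n → 1# ≤ (suc n ×′ 1#)

  0≤×1 zero    = ≤.refl
  0≤×1 (suc n) = ≤.trans 0≤1 (1≤suc×1 n)

  1≤suc×1 n = ≤.trans (≤.reflexive (sym (+-identityˡ 1#)))
                (≤.trans (+-mono-≤ 1# (0≤×1 n)) (≤.reflexive (trans (+-comm _ 1#) (sym (1+× n 1#)))))

  suc×1≉0 : ∀ n → ¬ suc n ×′ 1# ≈ 0#
  suc×1≉0 n eq = 0≉1 (≤.antisym 0≤1 (≤.trans (1≤suc×1 n) (≤.reflexive eq)))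

  x*y≈0⇒y≈0 : ∀ {x y} → ¬ x ≈ 0# → x * y ≈ 0# → y ≈ 0#
  x*y≈0⇒y≈0 {x} {y} x≉0 xy≈0 with inverse x x≉0
  ... | x⁻¹ , xx⁻¹≈1 = begin
    y              ≈⟨ *-identityˡ y ⟨
    1# * y         ≈⟨ *-cong xx⁻¹≈1 refl ⟨
    x * x⁻¹ * y    ≈⟨ solve 3 (λ x x⁻¹ y → x :* x⁻¹ :* y := x⁻¹ :* (x :* y)) refl x x⁻¹ y ⟩
    x⁻¹ * (x * y)  ≈⟨ *-cong refl xy≈0 ⟩
    x⁻¹ * 0#       ≈⟨ zeroʳ x⁻¹ ⟩
    0#             ∎

  fromℕ≈×1 : ∀ n → fromℕ n ≈ n ×′ 1#
  fromℕ≈×1 zero    = refl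
  fromℕ≈×1 (suc n) = trans (+-cong refl (fromℕ≈×1 n)) (sym (1+× n 1#))

  fromℕ²≈0⇒≡0 : ∀ n → fromℕ n * fromℕ n ≈ 0# → n ≡ 0
  fromℕ²≈0⇒≡0 zero    _  = ≡.refl
  fromℕ²≈0⇒≡0 (suc n) eq = ⊥-elim (n+1≉0 (x*y≈0⇒y≈0 n+1≉0 eq))
    where
    n+1≉0 : ¬ fromℕ (suc n) ≈ 0#
    n+1≉0 = suc×1≉0 n ∘ trans (sym (fromℕ≈×1 (suc n)))

  pairDistance²-×1 : ∀ {n} {i j k l : Fin n} → i ≢ j → k ≢ l →
    64 ×′ 1# * apart i k ×′ 1# + 225 ×′ 1# * apart j l ×′ 1# + 120 ×′ 1# * (apart i l ×′ 1# + apart k j ×′ 1#) - 240 ×′ 1#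
      ≈ fromℕ (pairDistance (i , j) (k , l)) * fromℕ (pairDistance (i , j) (k , l))
  pairDistance²-×1 {i = i} {j} {k} {l} i≢j k≢l = begin
    64 ×′ 1# * x ×′ 1# + 225 ×′ 1# * y ×′ 1# + 120 ×′ 1# * (z ×′ 1# + w ×′ 1#) - 240 ×′ 1#
      ≈⟨ +-cong embed refl ⟨
    (64 ℕ.* x ℕ.+ 225 ℕ.* y ℕ.+ 120 ℕ.* (z ℕ.+ w)) ×′ 1# - 240 ×′ 1#
      ≡⟨ ≡.cong (λ n → n ×′ 1# - 240 ×′ 1#) (pairDistance-square i≢j k≢l) ⟩
    (d ℕ.* d ℕ.+ 240) ×′ 1# - 240 ×′ 1#
      ≈⟨ +-cong (×-homo-+ 1# (d ℕ.* d) 240) refl ⟩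
    (d ℕ.* d) ×′ 1# + 240 ×′ 1# - 240 ×′ 1#
      ≈⟨ solve 2 (λ a b → a :+ b :- b := a) refl _ _ ⟩
    (d ℕ.* d) ×′ 1#
      ≈⟨ ×1-homo-* d d ⟩
    d ×′ 1# * d ×′ 1#
      ≈⟨ *-cong (fromℕ≈×1 d) (fromℕ≈×1 d) ⟨
    fromℕ d * fromℕ d ∎
    where
    x = apart i k
    y = apart j l
    z = apart i l
    w = apart k j
    d = pairDistance (i , j) (k , l)
    embed : (64 ℕ.* x ℕ.+ 225 ℕ.* y ℕ.+ 120 ℕ.* (z ℕ.+ w)) ×′ 1# ≈
            64 ×′ 1# * x ×′ 1# + 225 ×′ 1# * y ×′ 1# + 120 ×′ 1# * (z ×′ 1# + w ×′ 1#)
    embed = trans (×-homo-+ 1# (64 ℕ.* x ℕ.+ 225 ℕ.* y) (120 ℕ.* (z ℕ.+ w)))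
      (+-cong (trans (×-homo-+ 1# (64 ℕ.* x) (225 ℕ.* y)) (+-cong (×1-homo-* 64 x) (×1-homo-* 225 y)))
              (trans (×1-homo-* 120 (z ℕ.+ w)) (*-cong refl (×-homo-+ 1# z w))))

  Σᶠ-cong : ∀ {n} {f h : Fin n → Carrier} → (∀ t → f t ≈ h t) → Σᶠ f ≈ Σᶠ h
  Σᶠ-cong {zero}  f≈h = refl
  Σᶠ-cong {suc n} f≈h = +-cong (f≈h Fin.zero) (Σᶠ-cong (f≈h ∘ Fin.suc))

  Σᶠ-+ : ∀ {n} (f h : Fin n → Carrier) → Σᶠ (λ t → f t + h t) ≈ Σᶠ f + Σᶠ h
  Σᶠ-+ {zero}  f h = sym (+-identityˡ 0#)
  Σᶠ-+ {suc n} f h = trans (+-cong refl (Σᶠ-+ (f ∘ Fin.suc) (h ∘ Fin.suc)))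
    (solve 4 (λ a b x y → (a :+ b) :+ (x :+ y) := (a :+ x) :+ (b :+ y)) refl _ _ _ _)

  Σᶠ-- : ∀ {n} (f h : Fin n → Carrier) → Σᶠ (λ t → f t - h t) ≈ Σᶠ f - Σᶠ h
  Σᶠ-- {zero}  f h = sym (-‿inverseʳ 0#)
  Σᶠ-- {suc n} f h = trans (+-cong refl (Σᶠ-- (f ∘ Fin.suc) (h ∘ Fin.suc)))
    (solve 4 (λ a b x y → (a :- b) :+ (x :- y) := (a :+ x) :- (b :+ y)) refl _ _ _ _)

  Σᶠ-*ˡ : ∀ {n} x (f : Fin n → Carrier) → Σᶠ (λ t → x * f t) ≈ x * Σᶠ f
  Σᶠ-*ˡ {zero}  x f = sym (zeroʳ x)
  Σᶠ-*ˡ {suc n} x f = trans (+-cong refl (Σᶠ-*ˡ x (f ∘ Fin.suc))) (sym (distribˡ x _ _))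

  Σᶠ-const : ∀ {n} x → Σᶠ {n} (λ _ → x) ≈ n ×′ 1# * x
  Σᶠ-const {zero}  x = sym (zeroˡ x)
  Σᶠ-const {suc n} x = trans (+-cong (sym (*-identityˡ x)) (Σᶠ-const {n} x))
                             (trans (sym (distribʳ x _ _)) (*-cong (sym (1+× n 1#)) refl))

  infix 7 _∙_

  _∙_ : ∀ {m} → Point m → Point m → Carrier
  a ∙ p = Σᶠ (λ k → a k * p k)

  ∙-combinationʳ : ∀ {m} (a p q : Point m) α β →
                   a ∙ (λ k → α * p k + β * q k) ≈ α * (a ∙ p) + β * (a ∙ q)
  ∙-combinationʳ a p q α β = begin
    a ∙ (λ k → α * p k + β * q k)
      ≈⟨ Σᶠ-cong (λ k → solve 5 (λ a p q α β → a :* (α :* p :+ β :* q) := α :* (a :* p) :+ β :* (a :* q))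
                                 refl (a k) (p k) (q k) α β) ⟩
    Σᶠ (λ k → α * (a k * p k) + β * (a k * q k))
      ≈⟨ Σᶠ-+ (λ k → α * (a k * p k)) (λ k → β * (a k * q k)) ⟩
    Σᶠ (λ k → α * (a k * p k)) + Σᶠ (λ k → β * (a k * q k))
      ≈⟨ +-cong (Σᶠ-*ˡ α (λ k → a k * p k)) (Σᶠ-*ˡ β (λ k → a k * q k)) ⟩
    α * (a ∙ p) + β * (a ∙ q) ∎

  ∙-scaleʳ : ∀ {m} (a p : Point m) x → a ∙ (λ k → x * p k) ≈ x * (a ∙ p)
  ∙-scaleʳ a p x = trans (Σᶠ-cong (λ k → solve 3 (λ a p x → a :* (x :* p) := x :* (a :* p)) refl (a k) (p k) x))
                         (Σᶠ-*ˡ x (λ k → a k * p k))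

  ∙-constʳ : ∀ {m} (a : Point m) x → a ∙ (λ _ → x) ≈ x * Σᶠ a
  ∙-constʳ a x = trans (Σᶠ-cong (λ k → *-comm (a k) x)) (Σᶠ-*ˡ x a)

  basis : ∀ {m} → Fin m → Point m
  basis Fin.zero    Fin.zero    = 1#
  basis Fin.zero    (Fin.suc _) = 0#
  basis (Fin.suc _) Fin.zero    = 0#
  basis (Fin.suc i) (Fin.suc k) = basis i k

  basis-≡ : ∀ {m} (i : Fin m) → basis i i ≡ 1#
  basis-≡ Fin.zero    = ≡.refl
  basis-≡ (Fin.suc i) = basis-≡ i

  basis-≢ : ∀ {m} {i k : Fin m} → i ≢ k → basis i k ≡ 0#
  basis-≢ {i = Fin.zero}  {Fin.zero}  i≢k = contradiction ≡.refl i≢k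
  basis-≢ {i = Fin.zero}  {Fin.suc _} i≢k = ≡.refl
  basis-≢ {i = Fin.suc _} {Fin.zero}  i≢k = ≡.refl
  basis-≢ {i = Fin.suc i} {Fin.suc k} i≢k = basis-≢ (i≢k ∘ ≡.cong Fin.suc)

  ∙-basisʳ : ∀ {m} (p : Point m) i → p ∙ basis i ≈ p i
  ∙-basisʳ {suc m} p Fin.zero    = begin
    p Fin.zero * 1# + Σᶠ (λ k → p (Fin.suc k) * 0#) ≈⟨ +-cong (*-identityʳ _) (Σᶠ-cong {m} (λ k → zeroʳ _)) ⟩
    p Fin.zero + Σᶠ {m} (λ _ → 0#)                   ≈⟨ +-cong refl (trans (Σᶠ-const {m} 0#) (zeroʳ _)) ⟩
    p Fin.zero + 0#                                   ≈⟨ +-identityʳ _ ⟩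
    p Fin.zero                                        ∎
  ∙-basisʳ {suc m} p (Fin.suc i) = trans (+-cong (zeroʳ _) (∙-basisʳ (p ∘ Fin.suc) i)) (+-identityˡ _)

  dist²-expand : ∀ {m} (p q : Point m) → dist² p q ≈ p ∙ p + q ∙ q - 2 ×′ 1# * (p ∙ q)
  dist²-expand p q = begin
    dist² p q
      ≈⟨ Σᶠ-cong (λ k → solve 2 (λ x y → (x :- y) :* (x :- y) := x :* x :+ y :* y :- con (+ 2) :* (x :* y))
                                 refl (p k) (q k)) ⟩
    Σᶠ (λ k → p k * p k + q k * q k - 2 ×′ 1# * (p k * q k))
      ≈⟨ Σᶠ-- (λ k → p k * p k + q k * q k) (λ k → 2 ×′ 1# * (p k * q k)) ⟩
    Σᶠ (λ k → p k * p k + q k * q k) - Σᶠ (λ k → 2 ×′ 1# * (p k * q k))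
      ≈⟨ +-cong (Σᶠ-+ (λ k → p k * p k) (λ k → q k * q k)) (-‿cong (Σᶠ-*ˡ (2 ×′ 1#) (λ k → p k * q k))) ⟩
    p ∙ p + q ∙ q - 2 ×′ 1# * (p ∙ q) ∎

  dist²-sym : ∀ {m} (p q : Point m) → dist² p q ≈ dist² q p
  dist²-sym p q = Σᶠ-cong (λ k → solve 2 (λ x y → (x :- y) :* (x :- y) := (y :- x) :* (y :- x)) refl (p k) (q k))

  dist²≈0 : ∀ {m} {p q : Point m} → (∀ k → p k ≈ q k) → dist² p q ≈ 0#
  dist²≈0 {m} {p} {q} p≈q = begin
    dist² p q            ≈⟨ Σᶠ-cong (λ k → trans (*-cong (x≈y⇒x∙y⁻¹≈ε (p≈q k)) refl) (zeroˡ _)) ⟩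
    Σᶠ {m} (λ _ → 0#)    ≈⟨ Σᶠ-const {m} 0# ⟩
    m ×′ 1# * 0#         ≈⟨ zeroʳ _ ⟩
    0#                   ∎

  dist²-scale : ∀ {m} (p q : Point m) x → dist² (λ k → x * p k) (λ k → x * q k) ≈ x * x * dist² p q
  dist²-scale p q x = trans
    (Σᶠ-cong (λ k → solve 3 (λ x p q → (x :* p :- x :* q) :* (x :* p :- x :* q) := x :* x :* ((p :- q) :* (p :- q)))
                            refl x (p k) (q k)))
    (Σᶠ-*ˡ (x * x) (λ k → (p k - q k) * (p k - q k)))

  dist²-combination : ∀ {m} (a b c d : Point m) α β →
    dist² (λ k → α * a k + β * b k) (λ k → α * c k + β * d k) ≈
      α * α * dist² a c + β * β * dist² b d + α * β * (dist² a d + dist² c b - dist² a b - dist² c d)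
  dist²-combination a b c d α β = begin
    dist² (λ k → α * a k + β * b k) (λ k → α * c k + β * d k)
      ≈⟨ Σᶠ-cong (λ k → pointwise (a k) (b k) (c k) (d k)) ⟩
    Σᶠ (λ k → α * α * D a c k + β * β * D b d k + α * β * (D a d k + D c b k - D a b k - D c d k))
      ≈⟨ Σᶠ-+ (λ k → α * α * D a c k + β * β * D b d k) (λ k → α * β * (D a d k + D c b k - D a b k - D c d k)) ⟩
    Σᶠ (λ k → α * α * D a c k + β * β * D b d k) + Σᶠ (λ k → α * β * (D a d k + D c b k - D a b k - D c d k))
      ≈⟨ +-cong (Σᶠ-+ (λ k → α * α * D a c k) (λ k → β * β * D b d k))
                (Σᶠ-*ˡ (α * β) (λ k → D a d k + D c b k - D a b k - D c d k)) ⟩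
    Σᶠ (λ k → α * α * D a c k) + Σᶠ (λ k → β * β * D b d k) + α * β * Σᶠ (λ k → D a d k + D c b k - D a b k - D c d k)
      ≈⟨ +-cong (+-cong (Σᶠ-*ˡ (α * α) (D a c)) (Σᶠ-*ˡ (β * β) (D b d)))
                (*-cong refl (trans (Σᶠ-- (λ k → D a d k + D c b k - D a b k) (D c d))
                  (+-cong (trans (Σᶠ-- (λ k → D a d k + D c b k) (D a b)) (+-cong (Σᶠ-+ (D a d) (D c b)) refl)) refl))) ⟩
    α * α * dist² a c + β * β * dist² b d + α * β * (dist² a d + dist² c b - dist² a b - dist² c d) ∎
    where
    D : Point _ → Point _ → Fin _ → Carrier
    D p q k = (p k - q k) * (p k - q k)
    pointwise : ∀ a b c d → (α * a + β * b - (α * c + β * d)) * (α * a + β * b - (α * c + β * d)) ≈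
      α * α * ((a - c) * (a - c)) + β * β * ((b - d) * (b - d))
        + α * β * ((a - d) * (a - d) + (c - b) * (c - b) - (a - b) * (a - b) - (c - d) * (c - d))
    pointwise = solve 6 (λ α β a b c d →
      (α :* a :+ β :* b :- (α :* c :+ β :* d)) :* (α :* a :+ β :* b :- (α :* c :+ β :* d)) :=
      α :* α :* ((a :- c) :* (a :- c)) :+ β :* β :* ((b :- d) :* (b :- d))
        :+ α :* β :* ((a :- d) :* (a :- d) :+ (c :- b) :* (c :- b) :- (a :- b) :* (a :- b) :- (c :- d) :* (c :- d)))
      refl α β

  record RegularSimplex (m : ℕ) (edge² : Carrier) : Set (r ⊔ ℓ₁) where
    field
      vertex            : Fin (suc m) → Point m
      edge              : ∀ {i j} → i ≢ j → dist² (vertex i) (vertex j) ≈ edge²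
      affinelySpanning  : ∀ a → (∀ i → a ∙ vertex i ≈ a ∙ vertex Fin.zero) → ∀ k → a k ≈ 0#

  rescale : ∀ {m h} g → g * g * h ≈ 1# → RegularSimplex m h → RegularSimplex m 1#
  rescale {m} {h} g ggh≈1 S = record
    { vertex           = vertex′
    ; edge             = λ {i} {j} i≢j → trans (dist²-scale (vertex i) (vertex j) g) (trans (*-cong refl (edge i≢j)) ggh≈1)
    ; affinelySpanning = λ a const → affinelySpanning a (λ i → cancel (a ∙ vertex i) (a ∙ vertex Fin.zero)
                           (trans (sym (∙-scaleʳ a (vertex i) g)) (trans (const i) (∙-scaleʳ a (vertex Fin.zero) g))))
    }
    where
    open RegularSimplex S
    vertex′ : Fin (suc m) → Point m
    vertex′ i k = g * vertex i k
    g≉0 : ¬ g ≈ 0#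
    g≉0 g≈0 = 0≉1 (begin
      0#          ≈⟨ solve 2 (λ g h → con (+ 0) := con (+ 0) :* g :* h) refl g h ⟩
      0# * g * h  ≈⟨ *-cong (*-cong g≈0 refl) refl ⟨
      g * g * h   ≈⟨ ggh≈1 ⟩
      1#          ∎)
    cancel : ∀ x y → g * x ≈ g * y → x ≈ y
    cancel x y gx≈gy = x∙y⁻¹≈ε⇒x≈y x y (x*y≈0⇒y≈0 g≉0
      (trans (solve 3 (λ g x y → g :* (x :- y) := g :* x :- g :* y) refl g x y) (x≈y⇒x∙y⁻¹≈ε gx≈gy)))

  basis-edge : ∀ {m} {i j : Fin m} → i ≢ j → dist² (basis i) (basis j) ≈ 2 ×′ 1#
  basis-edge {i = i} {j} i≢j = begin
    dist² (basis i) (basis j)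
      ≈⟨ dist²-expand (basis i) (basis j) ⟩
    basis i ∙ basis i + basis j ∙ basis j - 2 ×′ 1# * (basis i ∙ basis j)
      ≈⟨ +-cong (+-cong (∙-basisʳ (basis i) i) (∙-basisʳ (basis j) j)) (-‿cong (*-cong refl (∙-basisʳ (basis i) j))) ⟩
    basis i i + basis j j - 2 ×′ 1# * basis i j
      ≡⟨ ≡.cong₂ (λ x y → x + y - 2 ×′ 1# * basis i j) (basis-≡ i) (basis-≡ j) ⟩
    1# + 1# - 2 ×′ 1# * basis i j
      ≡⟨ ≡.cong (λ z → 1# + 1# - 2 ×′ 1# * z) (basis-≢ i≢j) ⟩
    1# + 1# - 2 ×′ 1# * 0#
      ≈⟨ solve 0 (con (+ 1) :+ con (+ 1) :- con (+ 2) :* con (+ 0) := con (+ 2)) refl ⟩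
    2 ×′ 1# ∎

  -- The vertices are the standard basis together with c(1,…,1), where c = (1 - √(m+1))/m is a root of
  -- m c² - 2c - 1 = 0, which makes its distance to every basis vector √2.
  standardSimplex : ∀ n → RegularSimplex (suc n) (2 ×′ 1#)
  standardSimplex n = record
    { vertex           = v
    ; edge             = v-edge
    ; affinelySpanning = v-spanning
    }
    where
    M : Carrier
    M = suc n ×′ 1#
    s : Carrier
    s = proj₁ (sqrt (M + 1#) (0≤×1 (suc (suc n))))
    s²≈M+1 : s * s ≈ M + 1#
    s²≈M+1 = proj₂ (sqrt (M + 1#) (0≤×1 (suc (suc n))))
    M⁻¹ : Carrier
    M⁻¹ = proj₁ (inverse M (suc×1≉0 n))
    c : Carrier
    c = M⁻¹ * (1# - s)

    Mc≈1-s : M * c ≈ 1# - s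
    Mc≈1-s = trans (sym (*-assoc M M⁻¹ (1# - s)))
      (trans (*-cong (proj₂ (inverse M (suc×1≉0 n))) refl) (*-identityˡ _))

    Mc²-2c≈1 : M * (c * c) - 2 ×′ 1# * c ≈ 1#
    Mc²-2c≈1 = x∙y⁻¹≈ε⇒x≈y _ _ (x*y≈0⇒y≈0 (suc×1≉0 n) (begin
      M * (M * (c * c) - 2 ×′ 1# * c - 1#)
        ≈⟨ solve 3 (λ M c s → M :* (M :* (c :* c) :- con (+ 2) :* c :- con (+ 1)) :=
                               (M :* c :- (con (+ 1) :- s)) :* (M :* c :+ (con (+ 1) :- s) :- con (+ 2))
                                 :+ (s :* s :- (M :+ con (+ 1)))) refl M c s ⟩
      (M * c - (1# - s)) * (M * c + (1# - s) - 2 ×′ 1#) + (s * s - (M + 1#))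
        ≈⟨ +-cong (*-cong (x≈y⇒x∙y⁻¹≈ε Mc≈1-s) refl) (x≈y⇒x∙y⁻¹≈ε s²≈M+1) ⟩
      0# * (M * c + (1# - s) - 2 ×′ 1#) + 0#
        ≈⟨ trans (+-identityʳ _) (zeroˡ _) ⟩
      0# ∎))

    v : Fin (suc (suc n)) → Point (suc n)
    v Fin.zero    _ = c
    v (Fin.suc i)   = basis i

    apex-edge : ∀ i → dist² (v Fin.zero) (basis i) ≈ 2 ×′ 1#
    apex-edge i = begin
      dist² (λ _ → c) (basis i)
        ≈⟨ dist²-expand (λ _ → c) (basis i) ⟩
      Σᶠ {suc n} (λ _ → c * c) + basis i ∙ basis i - 2 ×′ 1# * ((λ _ → c) ∙ basis i)
        ≈⟨ +-cong (+-cong (Σᶠ-const {suc n} (c * c)) (∙-basisʳ (basis i) i)) (-‿cong (*-cong refl (∙-basisʳ (λ _ → c) i))) ⟩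
      M * (c * c) + basis i i - 2 ×′ 1# * c
        ≡⟨ ≡.cong (λ x → M * (c * c) + x - 2 ×′ 1# * c) (basis-≡ i) ⟩
      M * (c * c) + 1# - 2 ×′ 1# * c
        ≈⟨ solve 2 (λ M c → M :* (c :* c) :+ con (+ 1) :- con (+ 2) :* c :=
                            M :* (c :* c) :- con (+ 2) :* c :+ con (+ 1)) refl M c ⟩
      M * (c * c) - 2 ×′ 1# * c + 1#
        ≈⟨ +-cong Mc²-2c≈1 refl ⟩
      1# + 1#
        ≈⟨ solve 0 (con (+ 1) :+ con (+ 1) := con (+ 2)) refl ⟩
      2 ×′ 1# ∎

    v-edge : ∀ {i j} → i ≢ j → dist² (v i) (v j) ≈ 2 ×′ 1#
    v-edge {Fin.zero}  {Fin.zero}  0≢0 = contradiction ≡.refl 0≢0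
    v-edge {Fin.zero}  {Fin.suc j} _   = apex-edge j
    v-edge {Fin.suc i} {Fin.zero}  _   = trans (dist²-sym (basis i) (λ _ → c)) (apex-edge i)
    v-edge {Fin.suc i} {Fin.suc j} i≢j = basis-edge (i≢j ∘ ≡.cong Fin.suc)

    v-spanning : ∀ a → (∀ i → a ∙ v i ≈ a ∙ v Fin.zero) → ∀ k → a k ≈ 0#
    v-spanning a const k = begin
      a k          ≈⟨ ak≈cS k ⟩
      c * Σᶠ a     ≈⟨ *-cong refl S≈0 ⟩
      c * 0#       ≈⟨ zeroʳ c ⟩
      0#           ∎
      where
      ak≈cS : ∀ k → a k ≈ c * Σᶠ a
      ak≈cS k = trans (sym (∙-basisʳ a k)) (trans (const (Fin.suc k)) (∙-constʳ a c))
      sS≈0 : s * Σᶠ a ≈ 0#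
      sS≈0 = begin
        s * Σᶠ a                        ≈⟨ solve 2 (λ s S → s :* S := S :- (con (+ 1) :- s) :* S) refl s (Σᶠ a) ⟩
        Σᶠ a - (1# - s) * Σᶠ a          ≈⟨ +-cong refl (-‿cong (*-cong (sym Mc≈1-s) refl)) ⟩
        Σᶠ a - M * c * Σᶠ a             ≈⟨ +-cong refl (-‿cong (trans (*-assoc M c _) (sym (Σᶠ-const {suc n} (c * Σᶠ a))))) ⟩
        Σᶠ a - Σᶠ {suc n} (λ _ → c * Σᶠ a) ≈⟨ x≈y⇒x∙y⁻¹≈ε (Σᶠ-cong ak≈cS) ⟩
        0#                              ∎
      s≉0 : ¬ s ≈ 0#
      s≉0 s≈0 = suc×1≉0 (suc n) (trans (sym s²≈M+1) (trans (*-cong s≈0 refl) (zeroˡ s)))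
      S≈0 : Σᶠ a ≈ 0#
      S≈0 = x*y≈0⇒y≈0 s≉0 sS≈0

  unitSimplex : ∀ n → RegularSimplex (suc n) 1#
  unitSimplex n = rescale g g²2≈1 (standardSimplex n)
    where
    √2 : Carrier
    √2 = proj₁ (sqrt (2 ×′ 1#) (0≤×1 2))
    √2²≈2 : √2 * √2 ≈ 2 ×′ 1#
    √2²≈2 = proj₂ (sqrt (2 ×′ 1#) (0≤×1 2))
    √2≉0 : ¬ √2 ≈ 0#
    √2≉0 √2≈0 = suc×1≉0 1 (trans (sym √2²≈2) (trans (*-cong √2≈0 refl) (zeroˡ √2)))
    g : Carrier
    g = proj₁ (inverse √2 √2≉0)
    g²2≈1 : g * g * (2 ×′ 1#) ≈ 1#
    g²2≈1 = begin
      g * g * (2 ×′ 1#)    ≈⟨ *-cong refl √2²≈2 ⟨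
      g * g * (√2 * √2)    ≈⟨ solve 2 (λ g r → g :* g :* (r :* r) := (r :* g) :* (r :* g)) refl g √2 ⟩
      (√2 * g) * (√2 * g)  ≈⟨ *-cong (proj₂ (inverse √2 √2≉0)) (proj₂ (inverse √2 √2≉0)) ⟩
      1# * 1#              ≈⟨ *-identityˡ 1# ⟩
      1#                   ∎

  module _ {m} (S : RegularSimplex m 1#) where
    open RegularSimplex S

    vertex-dist² : ∀ i j → dist² (vertex i) (vertex j) ≈ apart i j ×′ 1#
    vertex-dist² i j with i Fin.≟ j
    ... | yes ≡.refl = dist²≈0 {p = vertex i} {q = vertex i} (λ _ → refl)
    ... | no i≢j     = edge i≢j

    pairPoint : Fin (suc m) × Fin (suc m) → Point m
    pairPoint (i , j) k = 8 ×′ 1# * vertex i k + 15 ×′ 1# * vertex j k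

    pairPoint-dist : ∀ p q → proj₁ p ≢ proj₂ p → proj₁ q ≢ proj₂ q →
                     DistIs (pairPoint p) (pairPoint q) (pairDistance p q)
    pairPoint-dist (i , j) (k , l) i≢j k≢l = begin
      dist² (pairPoint (i , j)) (pairPoint (k , l))
        ≈⟨ dist²-combination (vertex i) (vertex j) (vertex k) (vertex l) (8 ×′ 1#) (15 ×′ 1#) ⟩
      8 ×′ 1# * 8 ×′ 1# * N i k + 15 ×′ 1# * 15 ×′ 1# * N j l + 8 ×′ 1# * 15 ×′ 1# * (N i l + N k j - N i j - N k l)
        ≈⟨ +-cong (+-cong (*-cong refl (vertex-dist² i k)) (*-cong refl (vertex-dist² j l)))
                  (*-cong refl (+-cong (+-cong (+-cong (vertex-dist² i l) (vertex-dist² k j)) (-‿cong (edge i≢j)))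
                                       (-‿cong (edge k≢l)))) ⟩
      8 ×′ 1# * 8 ×′ 1# * X + 15 ×′ 1# * 15 ×′ 1# * Y + 8 ×′ 1# * 15 ×′ 1# * (Z + W - 1# - 1#)
        ≈⟨ solve 4 (λ X Y Z W → con (+ 8) :* con (+ 8) :* X :+ con (+ 15) :* con (+ 15) :* Y
                                  :+ con (+ 8) :* con (+ 15) :* (Z :+ W :- con (+ 1) :- con (+ 1)) :=
                                con (+ 64) :* X :+ con (+ 225) :* Y :+ con (+ 120) :* (Z :+ W) :- con (+ 240))
                   refl X Y Z W ⟩
      64 ×′ 1# * X + 225 ×′ 1# * Y + 120 ×′ 1# * (Z + W) - 240 ×′ 1#
        ≈⟨ pairDistance²-×1 i≢j k≢l ⟩
      fromℕ (pairDistance (i , j) (k , l)) * fromℕ (pairDistance (i , j) (k , l)) ∎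
      where
      N : Fin (suc m) → Fin (suc m) → Carrier
      N a b = dist² (vertex a) (vertex b)
      X = apart i k ×′ 1#
      Y = apart j l ×′ 1#
      Z = apart i l ×′ 1#
      W = apart k j ×′ 1#

    ∙-vertex-constant : ∀ a b → (∀ {i j} → i ≢ j → a ∙ pairPoint (i , j) ≈ b) →
                        ∀ i → a ∙ vertex i ≈ a ∙ vertex Fin.zero
    ∙-vertex-constant a b const i with i Fin.≟ Fin.zero
    ... | yes ≡.refl = refl
    ... | no i≢0     = x∙y⁻¹≈ε⇒x≈y _ _ (x*y≈0⇒y≈0 (suc×1≉0 6) (begin
      7 ×′ 1# * (L i - L₀)
        ≈⟨ solve 2 (λ Lᵢ L₀ → con (+ 7) :* (Lᵢ :- L₀) :=
                              (con (+ 8) :* L₀ :+ con (+ 15) :* Lᵢ) :- (con (+ 8) :* Lᵢ :+ con (+ 15) :* L₀)) refl (L i) L₀ ⟩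
      (8 ×′ 1# * L₀ + 15 ×′ 1# * L i) - (8 ×′ 1# * L i + 15 ×′ 1# * L₀)
        ≈⟨ x≈y⇒x∙y⁻¹≈ε swap ⟩
      0# ∎))
      where
      L : Fin (suc m) → Carrier
      L i = a ∙ vertex i
      L₀ = L Fin.zero
      swap : 8 ×′ 1# * L₀ + 15 ×′ 1# * L i ≈ 8 ×′ 1# * L i + 15 ×′ 1# * L₀
      swap = begin
        8 ×′ 1# * L₀ + 15 ×′ 1# * L i    ≈⟨ ∙-combinationʳ a (vertex Fin.zero) (vertex i) (8 ×′ 1#) (15 ×′ 1#) ⟨
        a ∙ pairPoint (Fin.zero , i)     ≈⟨ const (i≢0 ∘ ≡.sym) ⟩
        b                                ≈⟨ const i≢0 ⟨
        a ∙ pairPoint (i , Fin.zero)     ≈⟨ ∙-combinationʳ a (vertex i) (vertex Fin.zero) (8 ×′ 1#) (15 ×′ 1#) ⟩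
        8 ×′ 1# * L i + 15 ×′ 1# * L₀    ∎

    pairPoints : Fin (suc m ℕ.* m) → Point m
    pairPoints = pairPoint ∘ offDiagonal m

    pairPoints-dist : ∀ x y → DistIs (pairPoints x) (pairPoints y) (pairDistance (offDiagonal m x) (offDiagonal m y))
    pairPoints-dist x y = pairPoint-dist (offDiagonal m x) (offDiagonal m y) (offDiagonal-≢ m x) (offDiagonal-≢ m y)

    pairPoints-distinct : Distinct pairPoints
    pairPoints-distinct x y x≢y x≈y = x≢y (offDiagonal-injective m (pairDistance≡0⇒≡ (offDiagonal m x) (offDiagonal m y)
      (fromℕ²≈0⇒≡0 _ (trans (sym (pairPoints-dist x y)) (dist²≈0 x≈y)))))

    pairPoints-notInHyperplane : ¬ InHyperplane pairPoints
    pairPoints-notInHyperplane (a , b , (k , aₖ≉0) , onHyperplane) =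
      aₖ≉0 (affinelySpanning a (∙-vertex-constant a b pairConst) k)
      where
      pairConst : ∀ {i j} → i ≢ j → a ∙ pairPoint (i , j) ≈ b
      pairConst i≢j with offDiagonal-surjective m i≢j
      ... | x , x↦ij = ≡.subst (λ p → a ∙ pairPoint p ≈ b) x↦ij (onHyperplane x)

    unitSimplex⇒d≤17 : d≤ m (suc m ℕ.* m) 17
    unitSimplex⇒d≤17 =
      pairPoints ,
      (pairPoints-distinct , (λ x y → distance x y , pairPoints-dist x y) , pairPoints-notInHyperplane) ,
      (λ x y → distance x y , pairDistance≤17 (offDiagonal m x) (offDiagonal m y) , pairPoints-dist x y)
      where
      distance : Fin (suc m ℕ.* m) → Fin (suc m ℕ.* m) → ℕ
      distance x y = pairDistance (offDiagonal m x) (offDiagonal m y)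


open import Data.Nat using (_+_; _*_; _≤_)

theorem2 : ∀ {c ℓ₁ ℓ₂} (F : OrderedEuclideanField c ℓ₁ ℓ₂) (m : ℕ) → 1 ≤ m →
    Euclidean.d≤ F m (m * m + m) 17
theorem2 F (suc n) _ =
  ≡.subst (λ k → Euclidean.d≤ F (suc n) k 17) (ℕP.+-comm (suc n) (suc n * suc n)) (unitSimplex⇒d≤17 F (unitSimplex F n))
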